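{- Let $p>3$ be a prime, $\kappa\in\mathbb{Z}$ with $\kappa\not\equiv4\pmod p$, and $n\in\mathbb{Z}_{>0}$ with $2n+1\not\equiv0\pmod p$. Assume $\xi_{n,\kappa}\eta_{n,\kappa}\ne0$, that $T^{\mathrm{dist}}_{n,\kappa}(p)\ne\emptyset$, and let $(\alpha,\beta)\in T^{\mathrm{dist}}_{n,\kappa}(p)$, $\overline\alpha=\beta^2-\alpha$. (1) $\beta\ne0$ and $\overline\alpha\ne-\alpha$. (2) If moreover $B_{n,\kappa}(0)\ne0$, then $\alpha\ne0$ and $\overline\alpha\ne0$. (3) If moreover $\lambda_{n,\kappa}=\mathrm{Res}(A_n(x/2),x^3+3x^2-\kappa)\ne0$, then $\alpha\ne-\beta$ and $\overline\alpha\ne-\beta$; and, writing $K_{(\alpha,\beta)}=(X_1,X_2,X_3;Y_1,Y_2,Y_3)$, for every non-identity double sign change $\sigma$ and all $1\le i,j\le3$ we have $X_i,Y_j\notin\{\sigma(X_1),\sigma(X_2),\sigma(X_3),\sigma(Y_1),\sigma(Y_2),\sigma(Y_3)\}$.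
   Context: Everything is over $\mathbb{F}_p$. $A_m(x)\in\mathbb{Z}[x]$: $A_0=1$, $A_1=2x+1$, $A_{m+1}=2xA_m-A_{m-1}$. $f_\kappa(x,y)=y^2-x^2y+2x^2-\kappa$. $\xi_{n,\kappa}=\mathrm{Res}(A_n(x/2),x^3-3x^2+\kappa)$, $\eta_{n,\kappa}=\mathrm{Res}(A_n(x/2),x^4-8x^2+4\kappa)$, $B_{n,\kappa}(y)=\mathrm{Res}_x(A_n(x/2),f_\kappa(x,y))$. $T^{\mathrm{dist}}_{n,\kappa}(p)=\{(\alpha,\beta)\in\mathbb{F}_p\times\mathbb{F}_p^\times : A_n(\beta/2)=0,\ f_\kappa(\beta,\alpha)=0,\ \beta^2(3-\beta)\ne\kappa,\ \beta^2(8-\beta^2)\ne4\kappa\}$. $K_{(\alpha,\beta)}$ is the sextuple with $X_1=(\alpha,\beta,\beta)$, $X_2=(\beta,\alpha,\beta)$, $X_3=(\beta,\beta,\alpha)$, $Y_1=(\overline\alpha,\beta,\beta)$, $Y_2=(\beta,\overline\alpha,\beta)$, $Y_3=(\beta,\beta,\overline\alpha)$. The non-identity double sign changes are $(x,y,z)\mapsto(x,-y,-z)$, $(-x,y,-z)$, $(-x,-y,z)$. -}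

module Defs where

open import Data.Nat as ℕ using (ℕ; zero; suc; _≤ᵇ_; _<ᵇ_; _∸_)
open import Data.Integer as ℤ using (ℤ; +_; _+_; _*_; _-_; -_)
open import Data.Integer.Divisibility using (_∣_)
open import Data.Fin using (Fin; zero; suc; toℕ; punchIn)
open import Data.Bool using (if_then_else_; _∧_)
open import Data.Product using (_×_; _,_)
open import Relation.Nullary using (¬_)

-- Arithmetic in F_p, represented by integer representatives:
-- a ≡ b in F_p  iff  p ∣ a - b.

_≡_[mod_] : ℤ → ℤ → ℕ → Set
a ≡ b [mod p ] = (+ p) ∣ (a - b)

infix 4 _≡_[mod_]

-- Univariate integer polynomials given by a formal degree d and a
-- coefficient function c (c i = coefficient of x^i, i ≤ d).

eval : ℕ → (ℕ → ℤ) → ℤ → ℤ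
eval zero    c x = c 0
eval (suc d) c x = eval d c x + c (suc d) * (x ℤ.^ suc d)

shift : (ℕ → ℤ) → ℕ → ℤ
shift c zero    = + 0
shift c (suc i) = c i

-- C m = coefficient function of A_m(x/2) ∈ ℤ[x] (monic of degree m):
-- A_0(x/2) = 1, A_1(x/2) = x + 1, A_{m+1}(x/2) = x A_m(x/2) - A_{m-1}(x/2).
C : ℕ → ℕ → ℤ
C zero          zero    = + 1
C zero          (suc i) = + 0
C (suc zero)    zero    = + 1
C (suc zero)    (suc zero) = + 1
C (suc zero)    (suc (suc i)) = + 0
C (suc (suc m)) i = shift (C (suc m)) i - C m i

sumFin : ∀ {n} → (Fin n → ℤ) → ℤ
sumFin {zero}  f = + 0
sumFin {suc n} f = f zero + sumFin (λ j → f (suc j))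

sgn : ℕ → ℤ
sgn zero    = + 1
sgn (suc k) = - sgn k

det : ∀ n → (Fin n → Fin n → ℤ) → ℤ
det zero    M = + 1
det (suc n) M =
  sumFin (λ j → sgn (toℕ j) * M zero j * det n (λ i k → M (suc i) (punchIn j k)))

-- entry in column j of the row of the Sylvester matrix holding the
-- coefficients (descending) of a polynomial h of formal degree d,
-- shifted right by s
sylEntry : ℕ → (ℕ → ℤ) → ℕ → ℕ → ℤ
sylEntry d h s j =
  if (s ≤ᵇ j) ∧ ((j ∸ s) ≤ᵇ d) then h (d ∸ (j ∸ s)) else + 0

sylvester : (m k : ℕ) → (ℕ → ℤ) → (ℕ → ℤ) → Fin (m ℕ.+ k) → Fin (m ℕ.+ k) → ℤ
sylvester m k f g r j =
  if toℕ r <ᵇ k then sylEntry m f (toℕ r) (toℕ j)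
                else sylEntry k g (toℕ r ∸ k) (toℕ j)

Res : (m k : ℕ) → (ℕ → ℤ) → (ℕ → ℤ) → ℤ
Res m k f g = det (m ℕ.+ k) (sylvester m k f g)

cubP : ℤ → ℕ → ℤ
cubP κ 0 = κ
cubP κ 1 = + 0
cubP κ 2 = - (+ 3)
cubP κ 3 = + 1
cubP κ _ = + 0

cubM : ℤ → ℕ → ℤ
cubM κ 0 = - κ
cubM κ 1 = + 0
cubM κ 2 = + 3
cubM κ 3 = + 1
cubM κ _ = + 0

quart : ℤ → ℕ → ℤ
quart κ 0 = + 4 * κ
quart κ 1 = + 0
quart κ 2 = - (+ 8)
quart κ 3 = + 0
quart κ 4 = + 1
quart κ _ = + 0

-- f_κ(x, y) = (2 - y) x^2 + (y^2 - κ), as a polynomial in x of formal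
-- degree 2, with y specialised to an integer value y0.
fx : ℤ → ℤ → ℕ → ℤ
fx κ y0 0 = y0 * y0 - κ
fx κ y0 1 = + 0
fx κ y0 2 = + 2 - y0
fx κ y0 _ = + 0

f : ℤ → ℤ → ℤ → ℤ
f κ x y = y * y - x * x * y + + 2 * x * x - κ

ξ : ℕ → ℤ → ℤ
ξ n κ = Res n 3 (C n) (cubP κ)

η : ℕ → ℤ → ℤ
η n κ = Res n 4 (C n) (quart κ)

lam : ℕ → ℤ → ℤ
lam n κ = Res n 3 (C n) (cubM κ)

B : ℕ → ℤ → ℤ → ℤ
B n κ y0 = Res n 2 (C n) (fx κ y0)

InTdist : ℕ → ℕ → ℤ → ℤ → ℤ → Set
InTdist p n κ α β =
  (eval n (C n) β ≡ + 0 [mod p ]) ×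
  (f κ β α ≡ + 0 [mod p ]) ×
  ¬ (β ≡ + 0 [mod p ]) ×
  ¬ (β * β * (+ 3 - β) ≡ κ [mod p ]) ×
  ¬ (β * β * (+ 8 - β * β) ≡ + 4 * κ [mod p ])

Triple : Set
Triple = ℤ × ℤ × ℤ

_≈₃_[mod_] : Triple → Triple → ℕ → Set
(a , b , c) ≈₃ (a' , b' , c') [mod p ] =
  (a ≡ a' [mod p ]) × (b ≡ b' [mod p ]) × (c ≡ c' [mod p ])

infix 4 _≈₃_[mod_]

αbar : ℤ → ℤ → ℤ
αbar α β = β * β - α

KX : ℤ → ℤ → Fin 3 → Triple
KX α β zero             = (α , β , β)
KX α β (suc zero)       = (β , α , β)
KX α β (suc (suc zero)) = (β , β , α)

KY : ℤ → ℤ → Fin 3 → Triple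
KY α β i = KX (αbar α β) β i

nonIdDSC : Fin 3 → Triple → Triple
nonIdDSC zero             (x , y , z) = (x , - y , - z)
nonIdDSC (suc zero)       (x , y , z) = (- x , y , - z)
nonIdDSC (suc (suc zero)) (x , y , z) = (- x , - y , z)

module Submission where

-- If α or ᾱ were ≡ 0, resp. ≡ -β, then β would be a common root mod p of A_n(x/2) and of
-- f_κ(x, 0) = 2x² - κ, resp. x³ + 3x² - κ: each of these, evaluated at β, differs from
-- f_κ(β, α) ≡ 0 by a multiple of the vanishing quantity. A common root mod p makes p divide the
-- resultant: adding β times each column of the Sylvester matrix to the next (Horner's scheme) does
-- not change the determinant and turns the last column into multiples of the two values at β.
-- Part (1) is ᾱ + α = β² ≢ 0. For the sign changes, σ negates two coordinates, one of which is a
-- β-coordinate of the triple it is applied to; there the entries would give α ≡ -β, ᾱ ≡ -β or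
-- β ≡ -β, and p > 2.

open import Defs
open import Data.Nat using (ℕ)

module Determinant where

  open import Data.Nat using (ℕ; zero; suc)
  import Data.Nat.Properties as ℕ
  open import Data.Integer using (ℤ; _+_; _*_; -_; +0)
  import Data.Integer.Properties as ℤ
  open import Data.Integer.Divisibility.Signed using (_∣_; divides; ∣m∣n⇒∣m+n; ∣n⇒∣m*n; ∣m⇒∣m*n)
  open import Data.Integer.Tactic.RingSolver using (solve-∀)
  open import Data.Fin using (Fin; zero; suc; toℕ; punchIn; punchOut)
  import Data.Fin.Properties as Fin
  open import Data.Product using (Σ-syntax; _×_; _,_)
  open import Data.Sum using (_⊎_; inj₁; inj₂)
  open import Data.Empty using (⊥-elim)
  open import Function using (_∘_)
  open import Relation.Binary.PropositionalEquality
  open import Relation.Nullary using (yes; no)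
  open ≡-Reasoning

  Matrix : ℕ → Set
  Matrix n = Fin n → Fin n → ℤ

  minor : ∀ {n} → Fin (suc n) → Matrix (suc n) → Matrix n
  minor j M i k = M (suc i) (punchIn j k)

  cofactorTerm : ∀ {n} → Matrix (suc n) → Fin (suc n) → ℤ
  cofactorTerm {n} M j = sgn (toℕ j) * M zero j * det n (minor j M)

  ∣-zero : ∀ {d} → d ∣ +0
  ∣-zero = divides +0 refl

  sumFin-cong : ∀ {n} (g h : Fin n → ℤ) → (∀ j → g j ≡ h j) → sumFin g ≡ sumFin h
  sumFin-cong {zero}  g h e = refl
  sumFin-cong {suc n} g h e = cong₂ _+_ (e zero) (sumFin-cong (g ∘ suc) (h ∘ suc) (e ∘ suc))

  sumFin-zero : ∀ {n} (g : Fin n → ℤ) → (∀ j → g j ≡ +0) → sumFin g ≡ +0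
  sumFin-zero {zero}  g e = refl
  sumFin-zero {suc n} g e = cong₂ _+_ (e zero) (sumFin-zero (g ∘ suc) (e ∘ suc))

  sumFin-∣ : ∀ {n d} (g : Fin n → ℤ) → (∀ j → d ∣ g j) → d ∣ sumFin g
  sumFin-∣ {zero}  g d∣g = ∣-zero
  sumFin-∣ {suc n} g d∣g = ∣m∣n⇒∣m+n (d∣g zero) (sumFin-∣ (g ∘ suc) (d∣g ∘ suc))

  sumFin-linear : ∀ {n} (g h : Fin n → ℤ) s →
    sumFin (λ j → g j + s * h j) ≡ sumFin g + s * sumFin h
  sumFin-linear {zero}  g h s = sym (trans (ℤ.+-identityˡ _) (ℤ.*-zeroʳ s))
  sumFin-linear {suc n} g h s = begin
    g zero + s * h zero + sumFin (λ j → g (suc j) + s * h (suc j))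
      ≡⟨ cong (g zero + s * h zero +_) (sumFin-linear (g ∘ suc) (h ∘ suc) s) ⟩
    g zero + s * h zero + (sumFin (g ∘ suc) + s * sumFin (h ∘ suc))
      ≡⟨ interchange (g zero) (h zero) (sumFin (g ∘ suc)) (sumFin (h ∘ suc)) s ⟩
    g zero + sumFin (g ∘ suc) + s * (h zero + sumFin (h ∘ suc)) ∎
    where
    interchange : ∀ a b c d s → a + s * b + (c + s * d) ≡ a + c + s * (b + d)
    interchange = solve-∀

  det-cong : ∀ n (M N : Matrix n) → (∀ i j → M i j ≡ N i j) → det n M ≡ det n N
  det-cong zero    M N e = refl
  det-cong (suc n) M N e = sumFin-cong (cofactorTerm M) (cofactorTerm N) λ j →
    cong₂ (λ x y → sgn (toℕ j) * x * y) (e zero j)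
      (det-cong n (minor j M) (minor j N) (λ i k → e (suc i) (punchIn j k)))

  punchIn≢ : ∀ {n} {j c : Fin (suc n)} (j≢c : j ≢ c) (k : Fin n) →
    k ≢ punchOut j≢c → punchIn j k ≢ c
  punchIn≢ {j = j} j≢c k k≢ e =
    k≢ (Fin.punchIn-injective j k _ (trans e (sym (Fin.punchIn-punchOut j≢c))))

  det-linear-column : ∀ n (M M′ M″ : Matrix n) (c : Fin n) (s : ℤ) →
    (∀ i j → j ≢ c → M i j ≡ M′ i j) → (∀ i j → j ≢ c → M i j ≡ M″ i j) →
    (∀ i → M i c ≡ M′ i c + s * M″ i c) → det n M ≡ det n M′ + s * det n M″
  det-linear-column (suc n) M M′ M″ c s M≡M′ M≡M″ column =
    trans (sumFin-cong _ _ term) (sumFin-linear (cofactorTerm M′) (cofactorTerm M″) s)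
    where
    term : ∀ j → cofactorTerm M j ≡ cofactorTerm M′ j + s * cofactorTerm M″ j
    term j with j Fin.≟ c
    ... | yes refl = begin
      g * M zero j * det n (minor j M)
        ≡⟨ cong₂ (λ x y → g * x * y) (column zero) (minor≡ M′ M≡M′) ⟩
      g * (M′ zero j + s * M″ zero j) * det n (minor j M′)
        ≡⟨ distrib g (M′ zero j) (M″ zero j) (det n (minor j M′)) s ⟩
      g * M′ zero j * det n (minor j M′) + s * (g * M″ zero j * det n (minor j M′))
        ≡⟨ cong (λ y → cofactorTerm M′ j + s * (g * M″ zero j * y))
             (trans (sym (minor≡ M′ M≡M′)) (minor≡ M″ M≡M″)) ⟩
      cofactorTerm M′ j + s * cofactorTerm M″ j ∎
      where
      g = sgn (toℕ j)
      minor≡ : ∀ A → (∀ i k → k ≢ j → M i k ≡ A i k) → det n (minor j M) ≡ det n (minor j A)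
      minor≡ A M≡A = det-cong n _ _ λ i k → M≡A (suc i) (punchIn j k) (Fin.punchInᵢ≢i j k)
      distrib : ∀ g a b D s → g * (a + s * b) * D ≡ g * a * D + s * (g * b * D)
      distrib = solve-∀
    ... | no j≢c = begin
      g * M zero j * det n (minor j M)
        ≡⟨ cong (g * M zero j *_) minorLinear ⟩
      g * M zero j * (det n (minor j M′) + s * det n (minor j M″))
        ≡⟨ distrib g (M zero j) (det n (minor j M′)) (det n (minor j M″)) s ⟩
      g * M zero j * det n (minor j M′) + s * (g * M zero j * det n (minor j M″))
        ≡⟨ cong₂ (λ x y → g * x * det n (minor j M′) + s * (g * y * det n (minor j M″)))
             (M≡M′ zero j j≢c) (M≡M″ zero j j≢c) ⟩
      cofactorTerm M′ j + s * cofactorTerm M″ j ∎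
      where
      g = sgn (toℕ j)
      c′ = punchOut j≢c
      minorLinear : det n (minor j M) ≡ det n (minor j M′) + s * det n (minor j M″)
      minorLinear = det-linear-column n (minor j M) (minor j M′) (minor j M″) c′ s
        (λ i k k≢c′ → M≡M′ (suc i) (punchIn j k) (punchIn≢ j≢c k k≢c′))
        (λ i k k≢c′ → M≡M″ (suc i) (punchIn j k) (punchIn≢ j≢c k k≢c′))
        (λ i → subst (λ x → M (suc i) x ≡ M′ (suc i) x + s * M″ (suc i) x)
                 (sym (Fin.punchIn-punchOut j≢c)) (column (suc i)))
      distrib : ∀ g m D′ D″ s → g * m * (D′ + s * D″) ≡ g * m * D′ + s * (g * m * D″)
      distrib = solve-∀

  data Adjacent : ∀ {n} → Fin n → Fin n → Set where
    first : ∀ {n} → Adjacent {suc (suc n)} zero (suc zero)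
    later : ∀ {n} {c c′ : Fin n} → Adjacent c c′ → Adjacent (suc c) (suc c′)

  Adjacent-toℕ : ∀ {n} {c c′ : Fin n} → Adjacent c c′ → toℕ c′ ≡ suc (toℕ c)
  Adjacent-toℕ first = refl
  Adjacent-toℕ (later a) = cong suc (Adjacent-toℕ a)

  Adjacent⇒≢ : ∀ {n} {c c′ : Fin n} → Adjacent c c′ → c ≢ c′
  Adjacent⇒≢ a c≡c′ = ℕ.1+n≢n (sym (trans (cong toℕ c≡c′) (Adjacent-toℕ a)))

  Adjacent-sgn : ∀ {n} {c c′ : Fin n} → Adjacent c c′ → sgn (toℕ c′) ≡ - sgn (toℕ c)
  Adjacent-sgn first = refl
  Adjacent-sgn (later a) = cong -_ (Adjacent-sgn a)

  Adjacent-punchIn : ∀ {n} {c c′ : Fin (suc n)} → Adjacent c c′ → ∀ (k : Fin n) →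
    punchIn c k ≡ punchIn c′ k ⊎ (punchIn c k ≡ c′ × punchIn c′ k ≡ c)
  Adjacent-punchIn first zero = inj₂ (refl , refl)
  Adjacent-punchIn first (suc k) = inj₁ refl
  Adjacent-punchIn (later a) zero = inj₁ refl
  Adjacent-punchIn {suc n} (later a) (suc k) with Adjacent-punchIn a k
  ... | inj₁ e = inj₁ (cong suc e)
  ... | inj₂ (e , e′) = inj₂ (cong suc e , cong suc e′)

  Adjacent-punchOut : ∀ {n} {c c′ : Fin (suc n)} → Adjacent c c′ → (j : Fin (suc n)) →
    j ≢ c → j ≢ c′ →
    Σ[ d ∈ Fin n ] Σ[ d′ ∈ Fin n ] (Adjacent d d′ × punchIn j d ≡ c × punchIn j d′ ≡ c′)
  Adjacent-punchOut first zero j≢c j≢c′ = ⊥-elim (j≢c refl)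
  Adjacent-punchOut first (suc zero) j≢c j≢c′ = ⊥-elim (j≢c′ refl)
  Adjacent-punchOut {suc (suc n)} first (suc (suc j)) j≢c j≢c′ = zero , suc zero , first , refl , refl
  Adjacent-punchOut (later a) zero j≢c j≢c′ = _ , _ , a , refl , refl
  Adjacent-punchOut {suc n} (later a) (suc j) j≢c j≢c′
    with Adjacent-punchOut a j (j≢c ∘ cong suc) (j≢c′ ∘ cong suc)
  ... | d , d′ , a′ , e , e′ = suc d , suc d′ , later a′ , cong suc e , cong suc e′

  sumFin-adjacent : ∀ {n} {c c′ : Fin n} → Adjacent c c′ → (g : Fin n → ℤ) →
    (∀ j → j ≢ c → j ≢ c′ → g j ≡ +0) → g c + g c′ ≡ +0 → sumFin g ≡ +0
  sumFin-adjacent first g rest pair = begin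
    g zero + (g (suc zero) + sumFin (λ j → g (suc (suc j))))
      ≡⟨ cong (λ x → g zero + (g (suc zero) + x))
           (sumFin-zero _ λ j → rest (suc (suc j)) (λ ()) (λ ())) ⟩
    g zero + (g (suc zero) + +0)
      ≡⟨ cong (g zero +_) (ℤ.+-identityʳ _) ⟩
    g zero + g (suc zero)
      ≡⟨ pair ⟩
    +0 ∎
  sumFin-adjacent (later a) g rest pair =
    cong₂ _+_ (rest zero (λ ()) (λ ()))
      (sumFin-adjacent a (g ∘ suc)
         (λ j j≢c j≢c′ → rest (suc j) (j≢c ∘ Fin.suc-injective) (j≢c′ ∘ Fin.suc-injective))
         pair)

  det-adjacent-equal-columns : ∀ n (M : Matrix n) {c c′ : Fin n} → Adjacent c c′ →
    (∀ i → M i c ≡ M i c′) → det n M ≡ +0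
  det-adjacent-equal-columns (suc n) M {c} {c′} a same = sumFin-adjacent a (cofactorTerm M) rest pair
    where
    rest : ∀ j → j ≢ c → j ≢ c′ → cofactorTerm M j ≡ +0
    rest j j≢c j≢c′ with Adjacent-punchOut a j j≢c j≢c′
    ... | d , d′ , a′ , e , e′ =
      trans (cong (sgn (toℕ j) * M zero j *_)
              (det-adjacent-equal-columns n (minor j M) a′ λ i →
                trans (cong (M (suc i)) e) (trans (same (suc i)) (cong (M (suc i)) (sym e′)))))
            (ℤ.*-zeroʳ (sgn (toℕ j) * M zero j))
    sameMinor : det n (minor c M) ≡ det n (minor c′ M)
    sameMinor = det-cong n _ _ λ i k → entry i k (Adjacent-punchIn a k)
      where
      entry : ∀ i k → _ → M (suc i) (punchIn c k) ≡ M (suc i) (punchIn c′ k)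
      entry i k (inj₁ e) = cong (M (suc i)) e
      entry i k (inj₂ (e , e′)) =
        trans (cong (M (suc i)) e) (trans (sym (same (suc i))) (cong (M (suc i)) (sym e′)))
    pair : cofactorTerm M c + cofactorTerm M c′ ≡ +0
    pair rewrite Adjacent-sgn a | sym (same zero) | sameMinor =
      cancel (sgn (toℕ c)) (M zero c) (det n (minor c′ M))
      where
      cancel : ∀ g m D → g * m * D + - g * m * D ≡ +0
      cancel = solve-∀

  copyColumn : ∀ {n} → Fin n → Fin n → Matrix n → Matrix n
  copyColumn from to M i j with j Fin.≟ to
  ... | yes _ = M i from
  ... | no _ = M i j

  copyColumn-to : ∀ {n} (from to : Fin n) M i → copyColumn from to M i to ≡ M i from
  copyColumn-to from to M i with to Fin.≟ to
  ... | yes _ = refl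
  ... | no to≢to = ⊥-elim (to≢to refl)

  copyColumn-other : ∀ {n} (from to : Fin n) M i j → j ≢ to → copyColumn from to M i j ≡ M i j
  copyColumn-other from to M i j j≢to with j Fin.≟ to
  ... | yes j≡to = ⊥-elim (j≢to j≡to)
  ... | no _ = refl

  det-add-adjacent-column : ∀ n (M N : Matrix n) {c c′ : Fin n} → Adjacent c c′ → (s : ℤ) →
    (∀ i j → j ≢ c′ → N i j ≡ M i j) → (∀ i → N i c′ ≡ M i c′ + s * M i c) →
    det n N ≡ det n M
  det-add-adjacent-column n M N {c} {c′} a s N≡M column = begin
    det n N                          ≡⟨ det-linear-column n N M M″ c′ s N≡M N≡M″ column″ ⟩
    det n M + s * det n M″           ≡⟨ cong (λ x → det n M + s * x)
                                          (det-adjacent-equal-columns n M″ a sameColumns) ⟩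
    det n M + s * +0                 ≡⟨ cong (det n M +_) (ℤ.*-zeroʳ s) ⟩
    det n M + +0                     ≡⟨ ℤ.+-identityʳ _ ⟩
    det n M                          ∎
    where
    M″ = copyColumn c c′ M
    N≡M″ : ∀ i j → j ≢ c′ → N i j ≡ M″ i j
    N≡M″ i j j≢c′ = trans (N≡M i j j≢c′) (sym (copyColumn-other c c′ M i j j≢c′))
    column″ : ∀ i → N i c′ ≡ M i c′ + s * M″ i c′
    column″ i = trans (column i) (cong (λ x → M i c′ + s * x) (sym (copyColumn-to c c′ M i)))
    sameColumns : ∀ i → M″ i c ≡ M″ i c′
    sameColumns i = trans (copyColumn-other c c′ M i c (Adjacent⇒≢ a)) (sym (copyColumn-to c c′ M i))

  det-∣-column : ∀ {d} n (M : Matrix n) (c : Fin n) → (∀ i → d ∣ M i c) → d ∣ det n M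
  det-∣-column (suc n) M c d∣col = sumFin-∣ (cofactorTerm M) term
    where
    term : ∀ j → _ ∣ cofactorTerm M j
    term j with j Fin.≟ c
    ... | yes refl = ∣m⇒∣m*n (det n (minor j M)) (∣n⇒∣m*n (sgn (toℕ j)) (d∣col zero))
    ... | no j≢c = ∣n⇒∣m*n (sgn (toℕ j) * M zero j)
      (det-∣-column n (minor j M) (punchOut j≢c)
        λ i → subst (λ x → _ ∣ M (suc i) x) (sym (Fin.punchIn-punchOut j≢c)) (d∣col (suc i)))

module Resultant where

  open Determinant
  open import Data.Bool using (if_then_else_; true; false)
  open import Data.Nat as ℕ using (ℕ; zero; suc; _∸_; _≤ᵇ_; _<ᵇ_; _≤_; _<_)
  import Data.Nat.Properties as ℕ
  open import Data.Integer using (ℤ; +_; _+_; _*_; _^_; +0)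
  import Data.Integer.Properties as ℤ
  open import Data.Integer.Divisibility.Signed using (_∣_; ∣m∣n⇒∣m+n; ∣n⇒∣m*n)
  open import Data.Integer.Tactic.RingSolver using (solve-∀)
  open import Data.Fin using (Fin; zero; suc; toℕ; fromℕ<)
  import Data.Fin.Properties as Fin
  open import Data.Product using (Σ-syntax; _×_; _,_)
  open import Data.Empty using (⊥-elim)
  open import Function using (_∘_)
  open import Relation.Binary.PropositionalEquality
  open import Relation.Nullary using (yes; no; ofʸ; ofⁿ)
  open ≡-Reasoning

  eval-cong : ∀ t (c c′ : ℕ → ℤ) x → (∀ i → c i ≡ c′ i) → eval t c x ≡ eval t c′ x
  eval-cong zero    c c′ x e = e 0
  eval-cong (suc t) c c′ x e = cong₂ _+_ (eval-cong t c c′ x e) (cong (_* (x ^ suc t)) (e (suc t)))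

  eval-suc : ∀ t (c : ℕ → ℤ) x → eval (suc t) c x ≡ c 0 + x * eval t (c ∘ suc) x
  eval-suc zero    c x = linear (c 0) (c 1) x
    where
    linear : ∀ a b x → a + b * (x * + 1) ≡ a + x * b
    linear = solve-∀
  eval-suc (suc t) c x = begin
    eval (suc t) c x + c (suc (suc t)) * x ^ suc (suc t)
      ≡⟨ cong (_+ c (suc (suc t)) * x ^ suc (suc t)) (eval-suc t c x) ⟩
    c 0 + x * eval t (c ∘ suc) x + c (suc (suc t)) * (x * x ^ suc t)
      ≡⟨ factor (c 0) (eval t (c ∘ suc) x) (c (suc (suc t))) x (x ^ suc t) ⟩
    c 0 + x * eval (suc t) (c ∘ suc) x ∎
    where
    factor : ∀ a e b x y → a + x * e + b * (x * y) ≡ a + x * (e + b * y)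
    factor = solve-∀

  adjacentAt : ∀ {N} t → suc t < N →
    Σ[ c ∈ Fin N ] Σ[ c′ ∈ Fin N ] (Adjacent c c′ × toℕ c ≡ t)
  adjacentAt {suc (suc N)} zero    _ = zero , suc zero , first , refl
  adjacentAt {suc N}       (suc t) (ℕ.s≤s t+1<N) with adjacentAt t t+1<N
  ... | c , c′ , a , e = suc c , suc c′ , later a , cong suc e

  module _ (x : ℤ) where

    horner : (ℕ → ℤ) → ℕ → ℤ
    horner r zero    = r zero
    horner r (suc j) = x * horner r j + r (suc j)

    -- the row r after the column operations col j += x · col (j - 1) for j = 1, …, t, in this order
    hornerUpTo : ℕ → (ℕ → ℤ) → ℕ → ℤ
    hornerUpTo t r m with m ℕ.≤? t
    ... | yes _ = horner r m
    ... | no _  = r m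

    hornerUpTo-zero : ∀ r m → hornerUpTo 0 r m ≡ r m
    hornerUpTo-zero r zero    = refl
    hornerUpTo-zero r (suc m) = refl

    hornerUpTo-at : ∀ t r → hornerUpTo t r t ≡ horner r t
    hornerUpTo-at t r with t ℕ.≤? t
    ... | yes _  = refl
    ... | no t≰t = ⊥-elim (t≰t ℕ.≤-refl)

    hornerUpTo-other : ∀ t r m → m ≢ suc t → hornerUpTo (suc t) r m ≡ hornerUpTo t r m
    hornerUpTo-other t r m m≢t+1 with m ℕ.≤? suc t | m ℕ.≤? t
    ... | yes _     | yes _   = refl
    ... | yes m≤t+1 | no m≰t  = ⊥-elim (m≢t+1 (ℕ.≤-antisym m≤t+1 (ℕ.≰⇒> m≰t)))
    ... | no m≰t+1  | yes m≤t = ⊥-elim (m≰t+1 (ℕ.m≤n⇒m≤1+n m≤t))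
    ... | no _      | no _    = refl

    hornerUpTo-step : ∀ t r → hornerUpTo (suc t) r (suc t) ≡ hornerUpTo t r (suc t) + x * hornerUpTo t r t
    hornerUpTo-step t r with suc t ℕ.≤? suc t | suc t ℕ.≤? t
    ... | _        | yes t+1≤t = ⊥-elim (ℕ.<-irrefl refl t+1≤t)
    ... | no t≰t   | no _      = ⊥-elim (t≰t ℕ.≤-refl)
    ... | yes _    | no _ rewrite hornerUpTo-at t r = ℤ.+-comm (x * horner r t) (r (suc t))

    det-hornerUpTo : ∀ N (R : Fin N → ℕ → ℤ) t →
      det N (λ i j → hornerUpTo t (R i) (toℕ j)) ≡ det N (λ i j → R i (toℕ j))
    det-hornerUpTo N R zero    = det-cong N _ _ λ i j → hornerUpTo-zero (R i) (toℕ j)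
    det-hornerUpTo N R (suc t) = trans step (det-hornerUpTo N R t)
      where
      Level : ℕ → Matrix N
      Level u i j = hornerUpTo u (R i) (toℕ j)
      step : det N (Level (suc t)) ≡ det N (Level t)
      step with suc t ℕ.<? N
      ... | no t+1≮N = det-cong N _ _ λ i j → hornerUpTo-other t (R i) (toℕ j)
                         λ e → t+1≮N (subst (_< N) e (Fin.toℕ<n j))
      ... | yes t+1<N with adjacentAt t t+1<N
      ... | c , c′ , a , c≡t = det-add-adjacent-column N (Level t) (Level (suc t)) a x
              (λ i j j≢c′ → hornerUpTo-other t (R i) (toℕ j)
                                (j≢c′ ∘ Fin.toℕ-injective ∘ λ e → trans e (sym c′≡t+1)))
              column
        where
        c′≡t+1 : toℕ c′ ≡ suc t
        c′≡t+1 = trans (Adjacent-toℕ a) (cong suc c≡t)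
        column : ∀ i → Level (suc t) i c′ ≡ Level t i c′ + x * Level t i c
        column i rewrite c′≡t+1 | c≡t = hornerUpTo-step t (R i)

    det-∣-horner : ∀ {d} N (R : Fin N → ℕ → ℤ) (c : Fin N) →
      (∀ i → d ∣ horner (R i) (toℕ c)) → d ∣ det N (λ i j → R i (toℕ j))
    det-∣-horner N R c d∣ = subst (_ ∣_) (det-hornerUpTo N R (toℕ c))
      (det-∣-column N _ c λ i → subst (_ ∣_) (sym (hornerUpTo-at (toℕ c) (R i))) (d∣ i))

    horner-vanishing : ∀ r s → (∀ j → j < s → r j ≡ +0) → ∀ j → j < s → horner r j ≡ +0
    horner-vanishing r s r≡0 zero    j<s = r≡0 0 j<s
    horner-vanishing r s r≡0 (suc j) j<s
      rewrite horner-vanishing r s r≡0 j (ℕ.<-trans (ℕ.n<1+n j) j<s) | r≡0 (suc j) j<s =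
        trans (ℤ.+-identityʳ (x * +0)) (ℤ.*-zeroʳ x)

    horner-start : ∀ r s → (∀ j → j < s → r j ≡ +0) → horner r s ≡ r s
    horner-start r zero    r≡0 = refl
    horner-start r (suc s) r≡0
      rewrite horner-vanishing r (suc s) r≡0 s (ℕ.n<1+n s) | ℤ.*-zeroʳ x = ℤ.+-identityˡ (r (suc s))

    sylEntry-below : ∀ d h s j → j < s → sylEntry d h s j ≡ +0
    sylEntry-below d h s j j<s with s ≤ᵇ j | ℕ.≤ᵇ-reflects-≤ s j
    ... | false | _        = refl
    ... | true  | ofʸ s≤j = ⊥-elim (ℕ.<⇒≱ j<s s≤j)

    sylEntry-offset : ∀ d h s t → sylEntry d h s (s ℕ.+ t) ≡ (if t ≤ᵇ d then h (d ∸ t) else +0)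
    sylEntry-offset d h s t rewrite ℕ.m+n∸m≡n s t
       with s ≤ᵇ s ℕ.+ t | ℕ.≤ᵇ-reflects-≤ s (s ℕ.+ t)
    ... | true  | _          = refl
    ... | false | ofⁿ s≰s+t = ⊥-elim (s≰s+t (ℕ.m≤m+n s t))

    sylEntry-within : ∀ d h s t → t ≤ d → sylEntry d h s (s ℕ.+ t) ≡ h (d ∸ t)
    sylEntry-within d h s t t≤d rewrite sylEntry-offset d h s t with t ≤ᵇ d | ℕ.≤ᵇ-reflects-≤ t d
    ... | true  | _        = refl
    ... | false | ofⁿ t≰d = ⊥-elim (t≰d t≤d)

    sylEntry-above : ∀ d h s t → d < t → sylEntry d h s (s ℕ.+ t) ≡ +0
    sylEntry-above d h s t d<t rewrite sylEntry-offset d h s t with t ≤ᵇ d | ℕ.≤ᵇ-reflects-≤ t d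
    ... | false | _        = refl
    ... | true  | ofʸ t≤d = ⊥-elim (ℕ.<⇒≱ d<t t≤d)

    horner-sylEntry-within : ∀ d h s t → t ≤ d →
      horner (sylEntry d h s) (s ℕ.+ t) ≡ eval t (λ i → h (d ∸ t ℕ.+ i)) x
    horner-sylEntry-within d h s zero    _ = begin
      horner (sylEntry d h s) (s ℕ.+ 0) ≡⟨ cong (horner (sylEntry d h s)) (ℕ.+-identityʳ s) ⟩
      horner (sylEntry d h s) s         ≡⟨ horner-start (sylEntry d h s) s (sylEntry-below d h s) ⟩
      sylEntry d h s s                  ≡⟨ cong (sylEntry d h s) (sym (ℕ.+-identityʳ s)) ⟩
      sylEntry d h s (s ℕ.+ 0)          ≡⟨ sylEntry-within d h s 0 ℕ.z≤n ⟩
      h d                               ≡⟨ cong h (sym (ℕ.+-identityʳ d)) ⟩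
      h (d ℕ.+ 0)                       ∎
    horner-sylEntry-within d h s (suc t) t<d = begin
      horner (sylEntry d h s) (s ℕ.+ suc t)
        ≡⟨ cong (horner (sylEntry d h s)) (ℕ.+-suc s t) ⟩
      x * horner (sylEntry d h s) (s ℕ.+ t) + sylEntry d h s (suc (s ℕ.+ t))
        ≡⟨ cong₂ (λ u v → x * u + v) (horner-sylEntry-within d h s t (ℕ.<⇒≤ t<d))
             (trans (cong (sylEntry d h s) (sym (ℕ.+-suc s t))) (sylEntry-within d h s (suc t) t<d)) ⟩
      x * eval t (λ i → h (d ∸ t ℕ.+ i)) x + h (d ∸ suc t)
        ≡⟨ ℤ.+-comm (x * eval t (λ i → h (d ∸ t ℕ.+ i)) x) (h (d ∸ suc t)) ⟩
      h (d ∸ suc t) + x * eval t (λ i → h (d ∸ t ℕ.+ i)) x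
        ≡⟨ cong₂ (λ u v → u + x * v) (cong h (sym (ℕ.+-identityʳ (d ∸ suc t))))
             (eval-cong t _ _ x λ i → cong h (reindex i)) ⟩
      h (d ∸ suc t ℕ.+ 0) + x * eval t (λ i → h (d ∸ suc t ℕ.+ suc i)) x
        ≡⟨ eval-suc t (λ i → h (d ∸ suc t ℕ.+ i)) x ⟨
      eval (suc t) (λ i → h (d ∸ suc t ℕ.+ i)) x ∎
      where
      reindex : ∀ i → d ∸ t ℕ.+ i ≡ d ∸ suc t ℕ.+ suc i
      reindex i = trans (cong (ℕ._+ i) (ℕ.+-∸-assoc 1 t<d)) (sym (ℕ.+-suc (d ∸ suc t) i))

    horner-sylEntry-end : ∀ d h s → horner (sylEntry d h s) (s ℕ.+ d) ≡ eval d h x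
    horner-sylEntry-end d h s = trans (horner-sylEntry-within d h s d ℕ.≤-refl)
      (eval-cong d _ _ x λ i → cong (λ u → h (u ℕ.+ i)) (ℕ.n∸n≡0 d))

    horner-sylEntry-∣ : ∀ {D} d h s → D ∣ eval d h x →
      ∀ j → s ℕ.+ d ≤ j → D ∣ horner (sylEntry d h s) j
    horner-sylEntry-∣ {D} d h s D∣h j s+d≤j with ℕ.m≤n⇒∃[o]m+o≡n s+d≤j
    ... | e , refl = beyond e
      where
      beyond : ∀ e → D ∣ horner (sylEntry d h s) (s ℕ.+ d ℕ.+ e)
      beyond zero    = subst (λ j → D ∣ horner (sylEntry d h s) j) (sym (ℕ.+-identityʳ (s ℕ.+ d)))
                         (subst (D ∣_) (sym (horner-sylEntry-end d h s)) D∣h)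
      beyond (suc e) = subst (λ j → D ∣ horner (sylEntry d h s) j) (sym (ℕ.+-suc (s ℕ.+ d) e))
        (subst (λ v → D ∣ x * horner (sylEntry d h s) (s ℕ.+ d ℕ.+ e) + v) (sym entry≡0)
          (∣m∣n⇒∣m+n (∣n⇒∣m*n x (beyond e)) ∣-zero))
        where
        entry≡0 : sylEntry d h s (suc (s ℕ.+ d ℕ.+ e)) ≡ +0
        entry≡0 = trans
          (cong (sylEntry d h s) (trans (sym (ℕ.+-suc (s ℕ.+ d) e)) (ℕ.+-assoc s d (suc e))))
          (sylEntry-above d h s (d ℕ.+ suc e) (ℕ.m<m+n d ℕ.z<s))

    sylvesterRow : (m k : ℕ) → (ℕ → ℤ) → (ℕ → ℤ) → Fin (m ℕ.+ k) → ℕ → ℤ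
    sylvesterRow m k f g r j =
      if toℕ r <ᵇ k then sylEntry m f (toℕ r) j else sylEntry k g (toℕ r ∸ k) j

    common-root⇒∣Res : ∀ {D} m k f g → D ∣ eval m f x → D ∣ eval (suc k) g x →
      D ∣ Res m (suc k) f g
    common-root⇒∣Res m k f g D∣f D∣g =
      det-∣-horner (m ℕ.+ suc k) (sylvesterRow m (suc k) f g) last row∣
      where
      last<N : m ℕ.+ k < m ℕ.+ suc k
      last<N = ℕ.+-monoʳ-< m (ℕ.n<1+n k)
      last : Fin (m ℕ.+ suc k)
      last = fromℕ< last<N
      row∣ : ∀ r → _ ∣ horner (sylvesterRow m (suc k) f g r) (toℕ last)
      row∣ r rewrite Fin.toℕ-fromℕ< last<N with toℕ r <ᵇ suc k | ℕ.<ᵇ-reflects-< (toℕ r) (suc k)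
      ... | true  | ofʸ r<k+1 = horner-sylEntry-∣ m f (toℕ r) D∣f (m ℕ.+ k)
              (ℕ.≤-trans (ℕ.+-monoˡ-≤ m (ℕ.s≤s⁻¹ r<k+1)) (ℕ.≤-reflexive (ℕ.+-comm k m)))
      ... | false | ofⁿ r≮k+1 = horner-sylEntry-∣ (suc k) g (toℕ r ∸ suc k) D∣g (m ℕ.+ k)
              (ℕ.≤-trans (ℕ.≤-reflexive (ℕ.m∸n+n≡m (ℕ.≮⇒≥ r≮k+1)))
                 (ℕ.s≤s⁻¹ (subst (toℕ r <_) (ℕ.+-suc m k) (Fin.toℕ<n r))))

module RootConditions (p : ℕ) where

  open Resultant using (common-root⇒∣Res)
  import Data.Nat as ℕ
  import Data.Nat.Divisibility as ℕ
  open import Data.Nat.Primality using (Prime; euclidsLemma)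
  open import Data.Integer using (ℤ; +_; _+_; _*_; -_; _-_)
  import Data.Integer.Properties as ℤ
  open import Data.Integer.Divisibility.Signed using (_∣_; ∣ᵤ⇒∣; ∣⇒∣ᵤ; ∣m∣n⇒∣m+n; ∣n⇒∣m*n)
  open import Data.Integer.Tactic.RingSolver using (solve-∀)
  open import Data.Fin using (Fin; zero; suc)
  open import Data.Product using (Σ-syntax; _,_)
  open import Data.Sum as Sum using (_⊎_; inj₁; inj₂; [_,_]′)
  open import Function using (_∘_)
  open import Relation.Binary.PropositionalEquality
  open import Relation.Nullary using (¬_)

  mod⇒∣ : ∀ a b → a ≡ b [mod p ] → + p ∣ a - b
  mod⇒∣ a b = ∣ᵤ⇒∣

  ≡0⇒∣ : ∀ a → a ≡ + 0 [mod p ] → + p ∣ a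
  ≡0⇒∣ a a≡0 = subst (+ p ∣_) (ℤ.+-identityʳ a) (mod⇒∣ a (+ 0) a≡0)

  ∣⇒≡0 : ∀ a → + p ∣ a → a ≡ + 0 [mod p ]
  ∣⇒≡0 a p∣a = ∣⇒∣ᵤ (subst (+ p ∣_) (sym (ℤ.+-identityʳ a)) p∣a)

  module _ (p-prime : Prime p) where

    ∣*⇒∣⊎∣ : ∀ a b → + p ∣ a * b → + p ∣ a ⊎ + p ∣ b
    ∣*⇒∣⊎∣ a b p∣ab = Sum.map ∣ᵤ⇒∣ ∣ᵤ⇒∣ (euclidsLemma _ _ p-prime p∣∣a∣∣b∣)
      where
      p∣∣a∣∣b∣ = subst (p ℕ.∣_) (ℤ.abs-* a b) (∣⇒∣ᵤ {+ p} {a * b} p∣ab)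

    αbar≢-α : ∀ α β → ¬ (β ≡ + 0 [mod p ]) → ¬ (αbar α β ≡ - α [mod p ])
    αbar≢-α α β β≢0 ᾱ≡-α =
      β≢0 (∣⇒≡0 β (Sum.reduce (∣*⇒∣⊎∣ β β
        (subst (+ p ∣_) (difference α β) (mod⇒∣ (αbar α β) (- α) ᾱ≡-α)))))
      where
      difference : ∀ a b → b * b - a - - a ≡ b * b
      difference = solve-∀

    β≢-β : ∀ β → 2 ℕ.< p → ¬ (β ≡ + 0 [mod p ]) → ¬ (β ≡ - β [mod p ])
    β≢-β β 2<p β≢0 β≡-β = [ ℕ.>⇒∤ 2<p ∘ ∣⇒∣ᵤ , β≢0 ∘ ∣⇒≡0 β ]′ (∣*⇒∣⊎∣ (+ 2) β p∣2β)
      where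
      difference : ∀ b → b - - b ≡ + 2 * b
      difference = solve-∀
      p∣2β : + p ∣ + 2 * β
      p∣2β = subst (+ p ∣_) (difference β) (mod⇒∣ β (- β) β≡-β)

  -- The ring solver does not unfold eval and f, so each identity is proved on its unfolded form.
  fx₀-identity-α : ∀ α β κ → eval 2 (fx κ (+ 0)) β ≡ f κ β α + (β * β - α) * (α - + 0)
  fx₀-identity-α = ring
    where
    ring : ∀ a b k → + 0 * + 0 - k + + 0 * (b * + 1) + (+ 2 - + 0) * (b * (b * + 1))
                   ≡ (a * a - b * b * a + + 2 * b * b - k) + (b * b - a) * (a - + 0)
    ring = solve-∀

  fx₀-identity-αbar : ∀ α β κ → eval 2 (fx κ (+ 0)) β ≡ f κ β α + α * (αbar α β - + 0)
  fx₀-identity-αbar = ring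
    where
    ring : ∀ a b k → + 0 * + 0 - k + + 0 * (b * + 1) + (+ 2 - + 0) * (b * (b * + 1))
                   ≡ (a * a - b * b * a + + 2 * b * b - k) + a * ((b * b - a) - + 0)
    ring = solve-∀

  cubM-identity-α : ∀ α β κ → eval 3 (cubM κ) β ≡ f κ β α + (β + β * β - α) * (α - - β)
  cubM-identity-α = ring
    where
    ring : ∀ a b k → - k + + 0 * (b * + 1) + + 3 * (b * (b * + 1)) + + 1 * (b * (b * (b * + 1)))
                   ≡ (a * a - b * b * a + + 2 * b * b - k) + (b + b * b - a) * (a - - b)
    ring = solve-∀

  cubM-identity-αbar : ∀ α β κ → eval 3 (cubM κ) β ≡ f κ β α + (α + β) * (αbar α β - - β)
  cubM-identity-αbar = ring
    where
    ring : ∀ a b k → - k + + 0 * (b * + 1) + + 3 * (b * (b * + 1)) + + 1 * (b * (b * (b * + 1)))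
                   ≡ (a * a - b * b * a + + 2 * b * b - k) + (a + b) * ((b * b - a) - - b)
    ring = solve-∀

  module CommonRoot (n : ℕ) (κ α β : ℤ)
    (C[β]≡0 : eval n (C n) β ≡ + 0 [mod p ]) (f≡0 : f κ β α ≡ + 0 [mod p ]) where

    private
      Res≡0 : ∀ k g (v u : ℤ) → eval (ℕ.suc k) g β ≡ f κ β α + v * u → + p ∣ u →
        Res n (ℕ.suc k) (C n) g ≡ + 0 [mod p ]
      Res≡0 k g v u g[β]≡ p∣u = ∣⇒≡0 _ (common-root⇒∣Res β n k (C n) g p∣C[β] p∣g[β])
        where
        p∣C[β] = ≡0⇒∣ (eval n (C n) β) C[β]≡0
        p∣g[β] = subst (+ p ∣_) (sym g[β]≡) (∣m∣n⇒∣m+n (≡0⇒∣ (f κ β α) f≡0) (∣n⇒∣m*n v p∣u))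

    α≡0⇒B≡0 : α ≡ + 0 [mod p ] → B n κ (+ 0) ≡ + 0 [mod p ]
    α≡0⇒B≡0 α≡0 = Res≡0 1 (fx κ (+ 0)) (β * β - α) (α - + 0) (fx₀-identity-α α β κ)
      (mod⇒∣ α (+ 0) α≡0)

    αbar≡0⇒B≡0 : αbar α β ≡ + 0 [mod p ] → B n κ (+ 0) ≡ + 0 [mod p ]
    αbar≡0⇒B≡0 ᾱ≡0 = Res≡0 1 (fx κ (+ 0)) α (αbar α β - + 0) (fx₀-identity-αbar α β κ)
      (mod⇒∣ (αbar α β) (+ 0) ᾱ≡0)

    α≡-β⇒lam≡0 : α ≡ - β [mod p ] → lam n κ ≡ + 0 [mod p ]
    α≡-β⇒lam≡0 α≡-β = Res≡0 2 (cubM κ) (β + β * β - α) (α - - β) (cubM-identity-α α β κ)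
      (mod⇒∣ α (- β) α≡-β)

    αbar≡-β⇒lam≡0 : αbar α β ≡ - β [mod p ] → lam n κ ≡ + 0 [mod p ]
    αbar≡-β⇒lam≡0 ᾱ≡-β = Res≡0 2 (cubM κ) (α + β) (αbar α β - - β) (cubM-identity-αbar α β κ)
      (mod⇒∣ (αbar α β) (- β) ᾱ≡-β)

  coordinate : Fin 3 → Triple → ℤ
  coordinate zero             (x , _ , _) = x
  coordinate (suc zero)       (_ , y , _) = y
  coordinate (suc (suc zero)) (_ , _ , z) = z

  ≈₃⇒coordinate : ∀ {s t} → s ≈₃ t [mod p ] → ∀ w → coordinate w s ≡ coordinate w t [mod p ]
  ≈₃⇒coordinate {s = _ , _ , _} {_ , _ , _} (e , _ , _) zero             = e
  ≈₃⇒coordinate {s = _ , _ , _} {_ , _ , _} (_ , e , _) (suc zero)       = e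
  ≈₃⇒coordinate {s = _ , _ , _} {_ , _ , _} (_ , _ , e) (suc (suc zero)) = e

  KX-coordinate : ∀ a β w i → coordinate w (KX a β i) ≡ a ⊎ coordinate w (KX a β i) ≡ β
  KX-coordinate a β zero             zero             = inj₁ refl
  KX-coordinate a β zero             (suc zero)       = inj₂ refl
  KX-coordinate a β zero             (suc (suc zero)) = inj₂ refl
  KX-coordinate a β (suc zero)       zero             = inj₂ refl
  KX-coordinate a β (suc zero)       (suc zero)       = inj₁ refl
  KX-coordinate a β (suc zero)       (suc (suc zero)) = inj₂ refl
  KX-coordinate a β (suc (suc zero)) zero             = inj₂ refl
  KX-coordinate a β (suc (suc zero)) (suc zero)       = inj₂ refl
  KX-coordinate a β (suc (suc zero)) (suc (suc zero)) = inj₁ refl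

  -- σ negates two coordinates, so it negates some coordinate w other than the a′-coordinate k
  negated-β-coordinate : ∀ a′ β σ k →
    Σ[ w ∈ Fin 3 ] coordinate w (nonIdDSC σ (KX a′ β k)) ≡ - β
  negated-β-coordinate a′ β zero             zero             = suc zero , refl
  negated-β-coordinate a′ β zero             (suc zero)       = suc (suc zero) , refl
  negated-β-coordinate a′ β zero             (suc (suc zero)) = suc zero , refl
  negated-β-coordinate a′ β (suc zero)       zero             = suc (suc zero) , refl
  negated-β-coordinate a′ β (suc zero)       (suc zero)       = zero , refl
  negated-β-coordinate a′ β (suc zero)       (suc (suc zero)) = zero , refl
  negated-β-coordinate a′ β (suc (suc zero)) zero             = suc zero , refl
  negated-β-coordinate a′ β (suc (suc zero)) (suc zero)       = zero , refl
  negated-β-coordinate a′ β (suc (suc zero)) (suc (suc zero)) = zero , refl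

  KX≉nonIdDSC : ∀ a a′ β → ¬ (β ≡ - β [mod p ]) → ¬ (a ≡ - β [mod p ]) →
    ∀ σ i k → ¬ (KX a β i ≈₃ nonIdDSC σ (KX a′ β k) [mod p ])
  KX≉nonIdDSC a a′ β β≢-β a≢-β σ i k X≈σX′ with negated-β-coordinate a′ β σ k
  ... | w , σX′[w]≡-β =
    [ a≢-β ∘ coordinate≡-β , β≢-β ∘ coordinate≡-β ]′ (KX-coordinate a β w i)
    where
    coordinate≡-β : ∀ {u} → coordinate w (KX a β i) ≡ u → u ≡ - β [mod p ]
    coordinate≡-β X[w]≡u =
      subst₂ (λ l r → l ≡ r [mod p ]) X[w]≡u σX′[w]≡-β (≈₃⇒coordinate X≈σX′ w)

open import Data.Nat using (_<_; _*_; _+_)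
open import Data.Nat.Properties using (<⇒≤)
open import Data.Nat.Primality using (Prime)
open import Data.Integer using (ℤ; +_; -_)
open import Data.Fin using (Fin)
open import Data.Product using (_×_; _,_)
open import Function using (_∘_)
open import Relation.Nullary using (¬_)

lemma5p3 : (p : ℕ) → Prime p → 3 < p →
    (κ : ℤ) → ¬ (κ ≡ + 4 [mod p ]) →
    (n : ℕ) → 0 < n → ¬ (+ (2 * n + 1) ≡ + 0 [mod p ]) →
    ¬ (ξ n κ ≡ + 0 [mod p ]) → ¬ (η n κ ≡ + 0 [mod p ]) →
    (α β : ℤ) → InTdist p n κ α β →
      (¬ (β ≡ + 0 [mod p ]) × ¬ (αbar α β ≡ - α [mod p ]))
      × (¬ (B n κ (+ 0) ≡ + 0 [mod p ]) →
           ¬ (α ≡ + 0 [mod p ]) × ¬ (αbar α β ≡ + 0 [mod p ]))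
      × (¬ (lam n κ ≡ + 0 [mod p ]) →
           (¬ (α ≡ - β [mod p ]) × ¬ (αbar α β ≡ - β [mod p ]))
           × ((σ i k : Fin 3) →
                ¬ (KX α β i ≈₃ nonIdDSC σ (KX α β k) [mod p ])
                × ¬ (KX α β i ≈₃ nonIdDSC σ (KY α β k) [mod p ])
                × ¬ (KY α β i ≈₃ nonIdDSC σ (KX α β k) [mod p ])
                × ¬ (KY α β i ≈₃ nonIdDSC σ (KY α β k) [mod p ])))
lemma5p3 p p-prime 3<p κ _ n _ _ _ _ α β (C[β]≡0 , f≡0 , β≢0 , _ , _) =
  (β≢0 , αbar≢-α p-prime α β β≢0) ,
  (λ B≢0 → B≢0 ∘ α≡0⇒B≡0 , B≢0 ∘ αbar≡0⇒B≡0) ,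
  λ lam≢0 →
    let α≢-β = lam≢0 ∘ α≡-β⇒lam≡0
        ᾱ≢-β = lam≢0 ∘ αbar≡-β⇒lam≡0
        K≉ = λ a a′ a≢-β → KX≉nonIdDSC a a′ β (β≢-β p-prime β (<⇒≤ 3<p) β≢0) a≢-β
    in (α≢-β , ᾱ≢-β) ,
       λ σ i k → K≉ α α α≢-β σ i k , K≉ α (αbar α β) α≢-β σ i k ,
                 K≉ (αbar α β) α ᾱ≢-β σ i k , K≉ (αbar α β) (αbar α β) ᾱ≢-β σ i k
  where
  open RootConditions p
  open CommonRoot n κ α β C[β]≡0 f≡0
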